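{- Let $\phi(X)$ be an MSO$_1$ formula with one free vertex-set variable, $G=(V,E,\mathcal{C})$ a colored graph, and $S,S'\subseteq V$ with $G\models\phi(S)$, $G\models\phi(S')$, $|S|=|S'|=k$, where $S$ and $S'$ are among the colors of $\mathcal{C}$. If $R,R'\subseteq V$ have the same shape, then $G\models\phi(R)$ if and only if $G\models\phi(R')$.
   Context: A colored graph is $G=(V,E,\mathcal{C})$ with $\mathcal{C}=\langle C_1,\dots,C_c\rangle$ a tuple of subsets of $V$ (colors); $\mathcal{C}(v)$ is the set of colors containing $v$. MSO$_1$ formulas use vertex and vertex-set variables, atomic formulas $x=y$, $E(x,y)$, $C_i(x)$, $X(x)$, Boolean connectives and quantification over vertices and vertex sets. For an MSO$_1$ formula $\psi$, $\mathsf{q}(\psi)=2^{q_s}\cdot q_v$ where $q_s$ and $q_v$ are the numbers of set quantifiers and vertex quantifiers in $\psi$. Two vertices $u,v$ have the same type if they are twins ($N(u)=N(v)$ or $N[u]=N[v]$) and $\mathcal{C}(u)=\mathcal{C}(v)$; let $V_1,\dots,V_t$ be the partition of $V$ into types. The signature of $X\subseteq V$ is $\sigma_X:[t]\to\mathbb{Z}_{\ge0}$, $\sigma_X(i)=|V_i\cap X|$. A shape is a map $\bar\sigma$ on $[t]$ with $\bar\sigma(i)\in[0,\mathsf{q}(\phi)-1]\cup\{\bot\}\cup[|V_i|-\mathsf{q}(\phi)+1,|V_i|]$. A set $X$ has shape $\bar\sigma$ if for every $i$, $\bar\sigma(i)=\bot$ when $\mathsf{q}(\phi)\le\sigma_X(i)\le|V_i|-\mathsf{q}(\phi)$,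 and $\bar\sigma(i)=\sigma_X(i)$ otherwise. -}

module Defs where

open import Data.Nat using (ℕ; zero; suc; _+_; _*_; _^_; _≤ᵇ_)
open import Data.Bool using (Bool; true; false; _∧_; _∨_; not; if_then_else_)
open import Data.Bool.Properties using () renaming (_≟_ to _≟ᴮ_)
open import Data.Fin using (Fin; zero; suc; _≟_)
open import Data.Fin.Subset using (Subset; _∈_; _∉_; _∩_; ∣_∣)
open import Data.Vec using (tabulate; lookup)
open import Data.Maybe using (Maybe; just; nothing)
open import Data.Product using (Σ; _×_)
open import Data.Sum using (_⊎_)
open import Data.Empty using (⊥)
open import Relation.Nullary using (¬_; does)
open import Relation.Binary.PropositionalEquality using (_≡_)
import Data.Vec.Functional as VF

record ColoredGraph (n c : ℕ) : Set where
  field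
    adj    : Fin n → Fin n → Bool
    sym    : ∀ u v → adj u v ≡ adj v u
    irrefl : ∀ v → adj v v ≡ false
    color  : Fin c → Subset n
open ColoredGraph public

-- MSO₁ formulas over c colors, with nv free vertex variables (Fin nv)
-- and ns free vertex-set variables (Fin ns), de Bruijn style.

data Formula (c : ℕ) : ℕ → ℕ → Set where
  eqv   : ∀ {nv ns} → Fin nv → Fin nv → Formula c nv ns
  edge  : ∀ {nv ns} → Fin nv → Fin nv → Formula c nv ns
  col   : ∀ {nv ns} → Fin c → Fin nv → Formula c nv ns
  mem   : ∀ {nv ns} → Fin ns → Fin nv → Formula c nv ns
  neg   : ∀ {nv ns} → Formula c nv ns → Formula c nv ns
  conj  : ∀ {nv ns} → Formula c nv ns → Formula c nv ns → Formula c nv ns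
  disj  : ∀ {nv ns} → Formula c nv ns → Formula c nv ns → Formula c nv ns
  impl  : ∀ {nv ns} → Formula c nv ns → Formula c nv ns → Formula c nv ns
  iff   : ∀ {nv ns} → Formula c nv ns → Formula c nv ns → Formula c nv ns
  exV   : ∀ {nv ns} → Formula c (suc nv) ns → Formula c nv ns
  allV  : ∀ {nv ns} → Formula c (suc nv) ns → Formula c nv ns
  exS   : ∀ {nv ns} → Formula c nv (suc ns) → Formula c nv ns
  allS  : ∀ {nv ns} → Formula c nv (suc ns) → Formula c nv ns

qs : ∀ {c nv ns} → Formula c nv ns → ℕ
qs (eqv _ _)  = 0
qs (edge _ _) = 0
qs (col _ _)  = 0
qs (mem _ _)  = 0
qs (neg φ)    = qs φ
qs (conj φ ψ) = qs φ + qs ψ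
qs (disj φ ψ) = qs φ + qs ψ
qs (impl φ ψ) = qs φ + qs ψ
qs (iff φ ψ)  = qs φ + qs ψ
qs (exV φ)    = qs φ
qs (allV φ)   = qs φ
qs (exS φ)    = suc (qs φ)
qs (allS φ)   = suc (qs φ)

qv : ∀ {c nv ns} → Formula c nv ns → ℕ
qv (eqv _ _)  = 0
qv (edge _ _) = 0
qv (col _ _)  = 0
qv (mem _ _)  = 0
qv (neg φ)    = qv φ
qv (conj φ ψ) = qv φ + qv ψ
qv (disj φ ψ) = qv φ + qv ψ
qv (impl φ ψ) = qv φ + qv ψ
qv (iff φ ψ)  = qv φ + qv ψ
qv (exV φ)    = suc (qv φ)
qv (allV φ)   = suc (qv φ)
qv (exS φ)    = qv φ
qv (allS φ)   = qv φ

q : ∀ {c nv ns} → Formula c nv ns → ℕ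
q φ = 2 ^ qs φ * qv φ

Sat : ∀ {n c nv ns} → ColoredGraph n c → Formula c nv ns →
      (Fin nv → Fin n) → (Fin ns → Subset n) → Set
Sat G (eqv x y)  ρv ρs = ρv x ≡ ρv y
Sat G (edge x y) ρv ρs = adj G (ρv x) (ρv y) ≡ true
Sat G (col i x)  ρv ρs = ρv x ∈ color G i
Sat G (mem X x)  ρv ρs = ρv x ∈ ρs X
Sat G (neg φ)    ρv ρs = ¬ Sat G φ ρv ρs
Sat G (conj φ ψ) ρv ρs = Sat G φ ρv ρs × Sat G ψ ρv ρs
Sat G (disj φ ψ) ρv ρs = Sat G φ ρv ρs ⊎ Sat G ψ ρv ρs
Sat G (impl φ ψ) ρv ρs = Sat G φ ρv ρs → Sat G ψ ρv ρs
Sat G (iff φ ψ)  ρv ρs = (Sat G φ ρv ρs → Sat G ψ ρv ρs) × (Sat G ψ ρv ρs → Sat G φ ρv ρs)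
Sat G (exV φ)    ρv ρs = Σ (Fin _) λ v → Sat G φ (v VF.∷ ρv) ρs
Sat G (allV φ)   ρv ρs = (v : Fin _) → Sat G φ (v VF.∷ ρv) ρs
Sat G (exS φ)    ρv ρs = Σ (Subset _) λ X → Sat G φ ρv (X VF.∷ ρs)
Sat G (allS φ)   ρv ρs = (X : Subset _) → Sat G φ ρv (X VF.∷ ρs)

_⊨_[_] : ∀ {n c} → ColoredGraph n c → Formula c 0 1 → Subset n → Set
G ⊨ φ [ X ] = Sat G φ (λ ()) (λ _ → X)

allᵇ : ∀ {n} → (Fin n → Bool) → Bool
allᵇ {zero}  f = true
allᵇ {suc n} f = f zero ∧ allᵇ (λ i → f (suc i))

eqᵇ : Bool → Bool → Bool
eqᵇ a b = does (a ≟ᴮ b)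

openTwinᵇ : ∀ {n c} → ColoredGraph n c → Fin n → Fin n → Bool
openTwinᵇ G u v = allᵇ λ w → eqᵇ (adj G u w) (adj G v w)

closedAdj : ∀ {n c} → ColoredGraph n c → Fin n → Fin n → Bool
closedAdj G u w = adj G u w ∨ does (u ≟ w)

closedTwinᵇ : ∀ {n c} → ColoredGraph n c → Fin n → Fin n → Bool
closedTwinᵇ G u v = allᵇ λ w → eqᵇ (closedAdj G u w) (closedAdj G v w)

sameColorsᵇ : ∀ {n c} → ColoredGraph n c → Fin n → Fin n → Bool
sameColorsᵇ G u v = allᵇ λ i → eqᵇ (lookup (color G i) u) (lookup (color G i) v)

sameTypeᵇ : ∀ {n c} → ColoredGraph n c → Fin n → Fin n → Bool
sameTypeᵇ G u v = (openTwinᵇ G u v ∨ closedTwinᵇ G u v) ∧ sameColorsᵇ G u v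

typeClass : ∀ {n c} → ColoredGraph n c → Fin n → Subset n
typeClass G v = tabulate λ u → sameTypeᵇ G u v

-- Signatures and shapes.  The types V_1,…,V_t are indexed by
-- representative vertices v (V_i = typeClass G v).

signature : ∀ {n c} → ColoredGraph n c → Subset n → Fin n → ℕ
signature G X v = ∣ typeClass G v ∩ X ∣

-- shape value at one type: ⊥ (= nothing) if Q ≤ x ≤ s - Q, else x
shapeValue : (Q s x : ℕ) → Maybe ℕ
shapeValue Q s x = if (Q ≤ᵇ x) ∧ (x + Q ≤ᵇ s) then nothing else just x

shapeOf : ∀ {n c} → ColoredGraph n c → ℕ → Subset n → Fin n → Maybe ℕ
shapeOf G Q X v = shapeValue Q ∣ typeClass G v ∣ (signature G X v)

HasShape : ∀ {n c} → ColoredGraph n c → ℕ → Subset n → (Fin n → Maybe ℕ) → Set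
HasShape G Q X σ̄ = ∀ v → σ̄ v ≡ shapeOf G Q X v

SameShape : ∀ {n c} → ColoredGraph n c → ℕ → Subset n → Subset n → Set
SameShape G Q R R' = Σ (Fin _ → Maybe ℕ) λ σ̄ → HasShape G Q R σ̄ × HasShape G Q R' σ̄

-- Call two assignments of the free variables Q-similar when
-- they agree on equalities, on the types of the assigned vertices and on their
-- set memberships, and when, for every vertex type and every membership
-- pattern, the numbers of unassigned vertices of that type and pattern are
-- equal or both at least Q.  Vertices of the same type are twins with the same
-- colors, so adjacency between distinct vertices depends only on their types
-- and similar assignments satisfy the same atomic formulas.  Similarity
-- survives a move of the Ehrenfeucht–Fraïssé game: a vertex is answered by a
-- vertex with the same type and pattern (Q drops by one), a set by taking, in
-- every class, a part of matching size (Q is halved).  As q(φ) = 2^{q_s}·q_v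
-- pays for all moves of φ, and sets of the same shape are q(φ)-similar, φ
-- cannot tell them apart.

module Submission where

open import Defs hiding (sym)
open import Data.Bool using (Bool; true; false; _∧_; _∨_; not; if_then_else_)
open import Data.Bool.Properties using (∧-zeroʳ; ∧-identityʳ; ∨-identityʳ; ∨-zeroʳ; T-≡)
open import Data.Fin using (Fin; zero; suc; toℕ; _≟_)
open import Data.Fin.Properties using (any?)
open import Data.Fin.Subset using (Subset; ∣_∣; _∩_)
open import Data.Maybe.Properties using (just-injective)
open import Data.Nat using (ℕ; zero; suc; _+_; _*_; _^_; _∸_; _≤_; _⊓_; _<ᵇ_; _≤ᵇ_; _<?_; z≤n; s≤s)
open import Data.Nat.Properties
  using ( +-suc; +-comm; +-identityʳ; *-suc; *-assoc; m+n∸m≡n; m∸n≤m; m∸[m∸n]≡n; ⊓-zeroʳ; m≤n⇒m⊓n≡m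
        ; ≤-refl; ≤-trans; ≤-reflexive; <⇒≤; ≮⇒≥; n≤1+n; m≤m+n; m≤n+m; m+n≤o⇒m≤o∸n; ≤ᵇ⇒≤
        ; +-monoʳ-≤; +-monoˡ-≤; *-mono-≤; ^-monoʳ-≤; m^n>0 )
  renaming (_≟_ to _≟ℕ_)
open import Data.Product using (Σ; ∃; _×_; _,_; proj₁; proj₂)
open import Data.Sum using (_⊎_; inj₁; inj₂)
open import Data.Vec using ([]; _∷_; lookup; tabulate)
open import Data.Vec.Properties using (lookup∘tabulate; lookup-zipWith; []=⇒lookup; lookup⇒[]=)
open import Function using (_∘_; Equivalence)
open import Relation.Binary.PropositionalEquality
open import Relation.Nullary using (¬_; Dec; does; yes; no; contradiction)
open import Relation.Nullary.Decidable using (dec-true; dec-false)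
import Data.Vec.Functional as VF

allᵇ-sound : ∀ {n} (f : Fin n → Bool) → allᵇ f ≡ true → ∀ i → f i ≡ true
allᵇ-sound {suc n} f all-f zero    with f zero | all-f
... | true | _ = refl
allᵇ-sound {suc n} f all-f (suc i) with f zero | all-f
... | true | all-f∘suc = allᵇ-sound (f ∘ suc) all-f∘suc i

allᵇ-complete : ∀ {n} (f : Fin n → Bool) → (∀ i → f i ≡ true) → allᵇ f ≡ true
allᵇ-complete {zero}  f f≗true = refl
allᵇ-complete {suc n} f f≗true rewrite f≗true zero = allᵇ-complete (f ∘ suc) (f≗true ∘ suc)

allᵇ-cong : ∀ {n} {f g : Fin n → Bool} → (∀ i → f i ≡ g i) → allᵇ f ≡ allᵇ g
allᵇ-cong {zero}  f≗g = refl
allᵇ-cong {suc n} f≗g = cong₂ _∧_ (f≗g zero) (allᵇ-cong (f≗g ∘ suc))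

eqᵇ-sound : ∀ a b → eqᵇ a b ≡ true → a ≡ b
eqᵇ-sound true  true  _ = refl
eqᵇ-sound false false _ = refl

eqᵇ-refl : ∀ a → eqᵇ a a ≡ true
eqᵇ-refl true  = refl
eqᵇ-refl false = refl

allᵇ-eqᵇ-sound : ∀ {m} (f g : Fin m → Bool) → allᵇ (λ i → eqᵇ (f i) (g i)) ≡ true → ∀ i → f i ≡ g i
allᵇ-eqᵇ-sound f g all-eq i = eqᵇ-sound (f i) (g i) (allᵇ-sound _ all-eq i)

allᵇ-eqᵇ-complete : ∀ {m} (f g : Fin m → Bool) → (∀ i → f i ≡ g i) → allᵇ (λ i → eqᵇ (f i) (g i)) ≡ true
allᵇ-eqᵇ-complete f g f≗g = allᵇ-complete _ λ i → subst (λ b → eqᵇ (f i) b ≡ true) (f≗g i) (eqᵇ-refl (f i))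

true⇔true⇒≡ : ∀ {x y : Bool} → (x ≡ true → y ≡ true) → (y ≡ true → x ≡ true) → x ≡ y
true⇔true⇒≡ {true}  {true}  _   _   = refl
true⇔true⇒≡ {true}  {false} x→y _   = sym (x→y refl)
true⇔true⇒≡ {false} {true}  _   y→x = y→x refl
true⇔true⇒≡ {false} {false} _   _   = refl

eqᵇ-true : ∀ a → eqᵇ a true ≡ a
eqᵇ-true true  = refl
eqᵇ-true false = refl

eqᵇ-false : ∀ a → eqᵇ a false ≡ not a
eqᵇ-false true  = refl
eqᵇ-false false = refl

count : ∀ {n} → (Fin n → Bool) → ℕ
count {zero}  f = 0
count {suc n} f = if f zero then suc (count (f ∘ suc)) else count (f ∘ suc)

count-cong : ∀ {n} {f g : Fin n → Bool} → (∀ u → f u ≡ g u) → count f ≡ count g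
count-cong {zero}  f≗g = refl
count-cong {suc n} f≗g rewrite f≗g zero | count-cong (f≗g ∘ suc) = refl

count-false : ∀ {n} {f : Fin n → Bool} → (∀ u → f u ≡ false) → count f ≡ 0
count-false {zero}  f≗false = refl
count-false {suc n} f≗false rewrite f≗false zero = count-false (f≗false ∘ suc)

count-∧-+-∧-not : ∀ {n} (f g : Fin n → Bool) →
                  count (λ u → f u ∧ g u) + count (λ u → f u ∧ not (g u)) ≡ count f
count-∧-+-∧-not {zero}  f g = refl
count-∧-+-∧-not {suc n} f g with f zero | g zero
... | false | _     = count-∧-+-∧-not (f ∘ suc) (g ∘ suc)
... | true  | true  = cong suc (count-∧-+-∧-not (f ∘ suc) (g ∘ suc))
... | true  | false = trans (+-suc _ _) (cong suc (count-∧-+-∧-not (f ∘ suc) (g ∘ suc)))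

count-∧≤count : ∀ {n} (f g : Fin n → Bool) → count (λ u → f u ∧ g u) ≤ count f
count-∧≤count f g = ≤-trans (m≤m+n _ _) (≤-reflexive (count-∧-+-∧-not f g))

count-∧-not : ∀ {n} (f g : Fin n → Bool) →
              count (λ u → f u ∧ not (g u)) ≡ count f ∸ count (λ u → f u ∧ g u)
count-∧-not {n} f g = begin
  count f∧¬g                      ≡⟨ m+n∸m≡n (count f∧g) (count f∧¬g) ⟨
  count f∧g + count f∧¬g ∸ count f∧g ≡⟨ cong (_∸ count f∧g) (count-∧-+-∧-not f g) ⟩
  count f ∸ count f∧g             ∎
  where
  open ≡-Reasoning
  f∧g f∧¬g : Fin n → Bool
  f∧g  u = f u ∧ g u
  f∧¬g u = f u ∧ not (g u)

count-pos : ∀ {n} (f : Fin n → Bool) (u : Fin n) → f u ≡ true → 1 ≤ count f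
count-pos f zero    fu rewrite fu = s≤s z≤n
count-pos f (suc u) fu with f zero
... | true  = s≤s z≤n
... | false = count-pos (f ∘ suc) u fu

count-pos-witness : ∀ {n} (f : Fin n → Bool) → 1 ≤ count f → Σ (Fin n) λ u → f u ≡ true
count-pos-witness {suc n} f pos with f zero in f0
... | true  = zero , f0
... | false with count-pos-witness (f ∘ suc) pos
...   | u , fu = suc u , fu

count-remove : ∀ {n} (f : Fin n → Bool) (v : Fin n) → f v ≡ true →
               count f ≡ suc (count (λ u → f u ∧ not (does (u ≟ v))))
count-remove f zero fv rewrite fv = cong suc (count-cong λ u → sym (∧-identityʳ (f (suc u))))
count-remove f (suc v) fv with f zero
... | true  = cong suc (count-remove (f ∘ suc) v fv)
... | false = count-remove (f ∘ suc) v fv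

count-remove-absent : ∀ {n} (f : Fin n → Bool) (v : Fin n) → f v ≡ false →
                      count f ≡ count (λ u → f u ∧ not (does (u ≟ v)))
count-remove-absent f v fv = count-cong drop-v
  where
  drop-v : ∀ u → f u ≡ f u ∧ not (does (u ≟ v))
  drop-v u with u ≟ v
  ... | yes refl = trans fv (sym (∧-zeroʳ (f u)))
  ... | no _     = sym (∧-identityʳ (f u))

rank : ∀ {n} → (Fin n → Bool) → Fin n → ℕ
rank f u = count (λ z → (toℕ z <ᵇ toℕ u) ∧ f z)

count-rank< : ∀ {n} (f : Fin n → Bool) (k : ℕ) →
              count (λ u → f u ∧ (rank f u <ᵇ k)) ≡ k ⊓ count f
count-rank< {zero}  f k       = sym (⊓-zeroʳ k)
count-rank< {suc n} f zero    = count-false (λ u → ∧-zeroʳ (f u))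
count-rank< {suc n} f (suc k) with f zero
... | true  rewrite count-false {n} {λ _ → false} (λ _ → refl) = cong suc (count-rank< (f ∘ suc) k)
... | false = count-rank< (f ∘ suc) (suc k)

∣p∣≡count : ∀ {n} (p : Subset n) → ∣ p ∣ ≡ count (lookup p)
∣p∣≡count []          = refl
∣p∣≡count (true  ∷ p) = cong suc (∣p∣≡count p)
∣p∣≡count (false ∷ p) = ∣p∣≡count p

count-∧-eqᵇ : ∀ {n} (f g : Fin n → Bool) (t : Bool) →
              count (λ u → f u ∧ eqᵇ (g u) t) ≡
              (if t then count (λ u → f u ∧ g u) else count f ∸ count (λ u → f u ∧ g u))
count-∧-eqᵇ f g true  = count-cong λ u → cong (f u ∧_) (eqᵇ-true (g u))
count-∧-eqᵇ f g false = trans (count-cong λ u → cong (f u ∧_) (eqᵇ-false (g u))) (count-∧-not f g)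

infix 4 _≈[_]_
_≈[_]_ : ℕ → ℕ → ℕ → Set
a ≈[ Q ] b = a ≡ b ⊎ (Q ≤ a × Q ≤ b)

≈-sym : ∀ {Q a b} → a ≈[ Q ] b → b ≈[ Q ] a
≈-sym (inj₁ a≡b)       = inj₁ (sym a≡b)
≈-sym (inj₂ (Q≤a , Q≤b)) = inj₂ (Q≤b , Q≤a)

≈-mono : ∀ {Q Q'} → Q' ≤ Q → ∀ {a b} → a ≈[ Q ] b → a ≈[ Q' ] b
≈-mono Q'≤Q (inj₁ a≡b)       = inj₁ a≡b
≈-mono Q'≤Q (inj₂ (Q≤a , Q≤b)) = inj₂ (≤-trans Q'≤Q Q≤a , ≤-trans Q'≤Q Q≤b)

≈-pred : ∀ {Q a b} → suc a ≈[ suc Q ] suc b → a ≈[ Q ] b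
≈-pred (inj₁ refl)                 = inj₁ refl
≈-pred (inj₂ (s≤s Q≤a , s≤s Q≤b)) = inj₂ (Q≤a , Q≤b)

≈-pos : ∀ {Q a b} → a ≈[ suc Q ] b → 1 ≤ a → 1 ≤ b
≈-pos (inj₁ refl)        1≤a = 1≤a
≈-pos (inj₂ (_ , sQ≤b)) _   = ≤-trans (s≤s z≤n) sQ≤b

Q≤c∸d : ∀ {Q c d} → Q + Q ≤ c → d ≤ Q → Q ≤ c ∸ d
Q≤c∸d {Q} 2Q≤c d≤Q = m+n≤o⇒m≤o∸n Q (≤-trans (+-monoʳ-≤ Q d≤Q) 2Q≤c)

-- How much of a part of size c' to take so as to mimic taking x out of c.
matchingPart : (Q c c' x : ℕ) → ℕ
matchingPart Q c c' x with c ≟ℕ c' | x <? Q | c ∸ x <? Q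
... | yes _ | _     | _     = x
... | no _  | yes _ | _     = x
... | no _  | no _  | yes _ = c' ∸ (c ∸ x)
... | no _  | no _  | no _  = Q

matchingPart-spec : ∀ Q {c c' x} → c ≈[ Q + Q ] c' → x ≤ c →
  let x' = matchingPart Q c c' x in
  x' ≤ c' × x ≈[ Q ] x' × c ∸ x ≈[ Q ] c' ∸ x'
matchingPart-spec Q {c} {c'} {x} c≈c' x≤c with c ≟ℕ c' | x <? Q | c ∸ x <? Q | c≈c'
... | yes refl | _ | _ | _ = x≤c , inj₁ refl , inj₁ refl
... | no c≢c' | _ | _ | inj₁ c≡c' = contradiction c≡c' c≢c'
... | no _ | yes x<Q | _ | inj₂ (2Q≤c , 2Q≤c') =
  ≤-trans (<⇒≤ x<Q) (≤-trans (m≤m+n Q Q) 2Q≤c') , inj₁ refl ,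
  inj₂ (Q≤c∸d 2Q≤c (<⇒≤ x<Q) , Q≤c∸d 2Q≤c' (<⇒≤ x<Q))
... | no _ | no x≮Q | yes c∸x<Q | inj₂ (2Q≤c , 2Q≤c') =
  m∸n≤m c' (c ∸ x) ,
  inj₂ (≮⇒≥ x≮Q , Q≤c∸d 2Q≤c' (<⇒≤ c∸x<Q)) ,
  inj₁ (sym (m∸[m∸n]≡n (≤-trans (<⇒≤ c∸x<Q) (≤-trans (m≤m+n Q Q) 2Q≤c'))))
... | no _ | no x≮Q | no c∸x≮Q | inj₂ (2Q≤c , 2Q≤c') =
  ≤-trans (m≤m+n Q Q) 2Q≤c' ,
  inj₂ (≮⇒≥ x≮Q , ≤-refl) ,
  inj₂ (≮⇒≥ c∸x≮Q , Q≤c∸d 2Q≤c' ≤-refl)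

≈-if : ∀ {Q a a' b b'} (t : Bool) → a ≈[ Q ] a' → b ≈[ Q ] b' →
       (if t then a else b) ≈[ Q ] (if t then a' else b')
≈-if true  a≈a' _    = a≈a'
≈-if false _    b≈b' = b≈b'

count-remove-≈ : ∀ {Q n} {f g : Fin n → Bool} {v v'} →
                 count f ≈[ suc Q ] count g → f v ≡ g v' →
                 count (λ u → f u ∧ not (does (u ≟ v))) ≈[ Q ] count (λ u → g u ∧ not (does (u ≟ v')))
count-remove-≈ {f = f} {g} {v} {v'} f≈g fv≡gv' with f v in fv
... | true  = ≈-pred (subst₂ _≈[ _ ]_ (count-remove f v fv) (count-remove g v' (sym fv≡gv')) f≈g)
... | false = ≈-mono (n≤1+n _)
  (subst₂ _≈[ _ ]_ (count-remove-absent f v fv) (count-remove-absent g v' (sym fv≡gv')) f≈g)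

-- Twins and vertex types

module VertexTypes {n c : ℕ} (G : ColoredGraph n c) where

  OpenTwins ClosedTwins Twins SameColors SameType : Fin n → Fin n → Set
  OpenTwins   a b = ∀ w → adj G a w ≡ adj G b w
  ClosedTwins a b = ∀ w → closedAdj G a w ≡ closedAdj G b w
  Twins       a b = OpenTwins a b ⊎ ClosedTwins a b
  SameColors  a b = ∀ i → lookup (color G i) a ≡ lookup (color G i) b
  SameType    a b = Twins a b × SameColors a b

  sameTypeᵇ-sound : ∀ a b → sameTypeᵇ G a b ≡ true → SameType a b
  sameTypeᵇ-sound a b same with openTwinᵇ G a b in open? | closedTwinᵇ G a b in closed?
  ... | true | _ = inj₁ (allᵇ-eqᵇ-sound _ _ open?) , allᵇ-eqᵇ-sound _ _ same
  ... | false | true = inj₂ (allᵇ-eqᵇ-sound _ _ closed?) , allᵇ-eqᵇ-sound _ _ same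

  sameTypeᵇ-complete : ∀ a b → SameType a b → sameTypeᵇ G a b ≡ true
  sameTypeᵇ-complete a b (inj₁ open-ab , colors)
    rewrite allᵇ-eqᵇ-complete (adj G a) (adj G b) open-ab = allᵇ-eqᵇ-complete _ _ colors
  sameTypeᵇ-complete a b (inj₂ closed-ab , colors)
    rewrite allᵇ-eqᵇ-complete (closedAdj G a) (closedAdj G b) closed-ab | ∨-zeroʳ (openTwinᵇ G a b)
    = allᵇ-eqᵇ-complete _ _ colors

  closedAdj-≢ : ∀ {a w} → a ≢ w → closedAdj G a w ≡ adj G a w
  closedAdj-≢ {a} {w} a≢w rewrite dec-false (a ≟ w) a≢w = ∨-identityʳ (adj G a w)

  closedAdj-self : ∀ w → closedAdj G w w ≡ true
  closedAdj-self w rewrite dec-true (w ≟ w) refl = ∨-zeroʳ (adj G w w)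

  twins-adj : ∀ {a b} → Twins a b → ∀ {w} → w ≢ a → w ≢ b → adj G a w ≡ adj G b w
  twins-adj (inj₁ open-ab)   {w} _   _   = open-ab w
  twins-adj (inj₂ closed-ab) {w} w≢a w≢b = begin
    adj G _ w       ≡⟨ closedAdj-≢ (w≢a ∘ sym) ⟨
    closedAdj G _ w ≡⟨ closed-ab w ⟩
    closedAdj G _ w ≡⟨ closedAdj-≢ (w≢b ∘ sym) ⟩
    adj G _ w       ∎
    where open ≡-Reasoning

  Twins-sym : ∀ {a b} → Twins a b → Twins b a
  Twins-sym (inj₁ open-ab)   = inj₁ (sym ∘ open-ab)
  Twins-sym (inj₂ closed-ab) = inj₂ (sym ∘ closed-ab)

  -- For pairwise distinct a, b, c this case is impossible: b ~ c but b ≁ a,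
  -- yet N(a) = N(b) gives a ~ c and then N[b] = N[c] gives b ~ a.
  open-closed-twins : ∀ {a b c} → OpenTwins a b → ClosedTwins b c → Twins a c
  open-closed-twins {a} {b} {c} open-ab closed-bc with a ≟ b | b ≟ c | a ≟ c
  ... | yes refl | _        | _        = inj₂ closed-bc
  ... | no _     | yes refl | _        = inj₁ open-ab
  ... | no _     | no _     | yes refl = inj₁ λ _ → refl
  ... | no a≢b   | no b≢c   | no a≢c   = contradiction false≡true λ ()
    where
    open ≡-Reasoning
    false≡true : false ≡ true
    false≡true = begin
      false         ≡⟨ irrefl G b ⟨
      adj G b b     ≡⟨ open-ab b ⟨
      adj G a b     ≡⟨ ColoredGraph.sym G a b ⟩
      adj G b a     ≡⟨ twins-adj (inj₂ closed-bc) (a≢b) a≢c ⟩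
      adj G c a     ≡⟨ ColoredGraph.sym G c a ⟩
      adj G a c     ≡⟨ open-ab c ⟩
      adj G b c     ≡⟨ closedAdj-≢ b≢c ⟨
      closedAdj G b c ≡⟨ closed-bc c ⟩
      closedAdj G c c ≡⟨ closedAdj-self c ⟩
      true          ∎

  Twins-trans : ∀ {a b c} → Twins a b → Twins b c → Twins a c
  Twins-trans (inj₁ open-ab)   (inj₁ open-bc)   = inj₁ λ w → trans (open-ab w) (open-bc w)
  Twins-trans (inj₂ closed-ab) (inj₂ closed-bc) = inj₂ λ w → trans (closed-ab w) (closed-bc w)
  Twins-trans (inj₁ open-ab)   (inj₂ closed-bc) = open-closed-twins open-ab closed-bc
  Twins-trans (inj₂ closed-ab) (inj₁ open-bc)   =
    Twins-sym (open-closed-twins (sym ∘ open-bc) (sym ∘ closed-ab))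

  SameType-refl : ∀ a → SameType a a
  SameType-refl a = inj₁ (λ _ → refl) , λ _ → refl

  SameType-sym : ∀ {a b} → SameType a b → SameType b a
  SameType-sym (twins , colors) = Twins-sym twins , sym ∘ colors

  SameType-trans : ∀ {a b c} → SameType a b → SameType b c → SameType a c
  SameType-trans (twins , colors) (twins' , colors') =
    Twins-trans twins twins' , λ i → trans (colors i) (colors' i)

  adj-SameType : ∀ {a a' b b'} → SameType a a' → SameType b b' → a ≢ b → a' ≢ b' →
                 adj G a b ≡ adj G a' b'
  adj-SameType {a} {a'} {b} {b'} (twins-a , _) (twins-b , _) a≢b a'≢b' with b ≟ a'
  ... | no b≢a' = begin
    adj G a b   ≡⟨ twins-adj twins-a (a≢b ∘ sym) b≢a' ⟩
    adj G a' b  ≡⟨ ColoredGraph.sym G a' b ⟩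
    adj G b a'  ≡⟨ twins-adj twins-b (b≢a' ∘ sym) a'≢b' ⟩
    adj G b' a' ≡⟨ ColoredGraph.sym G b' a' ⟩
    adj G a' b' ∎
    where open ≡-Reasoning
  ... | yes refl with a ≟ b'
  ...   | yes refl = ColoredGraph.sym G a b
  ...   | no a≢b' = begin
    adj G a b   ≡⟨ ColoredGraph.sym G a b ⟩
    adj G b a   ≡⟨ twins-adj twins-b a≢b a≢b' ⟩
    adj G b' a  ≡⟨ ColoredGraph.sym G b' a ⟩
    adj G a b'  ≡⟨ twins-adj twins-a (a≢b' ∘ sym) (a'≢b' ∘ sym) ⟩
    adj G b b'  ∎
    where open ≡-Reasoning

middle⇒≥ : ∀ Q s x → (Q ≤ᵇ x) ∧ (x + Q ≤ᵇ s) ≡ true → Q ≤ x × Q ≤ s ∸ x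
middle⇒≥ Q s x middle with Q ≤ᵇ x in Q≤ᵇx
... | true = ≤ᵇ⇒≤ Q x (T-≡ .from Q≤ᵇx) ,
             m+n≤o⇒m≤o∸n Q (≤-trans (≤-reflexive (+-comm Q x)) (≤ᵇ⇒≤ (x + Q) s (T-≡ .from middle)))
  where open Equivalence

shapeValue-≈ : ∀ Q s x x' → shapeValue Q s x ≡ shapeValue Q s x' →
               x ≈[ Q ] x' × s ∸ x ≈[ Q ] s ∸ x'
shapeValue-≈ Q s x x' same
  with (Q ≤ᵇ x) ∧ (x + Q ≤ᵇ s) in middle | (Q ≤ᵇ x') ∧ (x' + Q ≤ᵇ s) in middle'
... | false | false = inj₁ (just-injective same) , inj₁ (cong (s ∸_) (just-injective same))
... | true  | true  with middle⇒≥ Q s x middle | middle⇒≥ Q s x' middle'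
...   | Q≤x , Q≤s∸x | Q≤x' , Q≤s∸x' = inj₂ (Q≤x , Q≤x') , inj₂ (Q≤s∸x , Q≤s∸x')

module _ {c nv ns : ℕ} (φ ψ : Formula c nv ns) {Q : ℕ} where

  q-binaryˡ : 2 ^ (qs φ + qs ψ) * (qv φ + qv ψ) ≤ Q → q φ ≤ Q
  q-binaryˡ = ≤-trans (*-mono-≤ (^-monoʳ-≤ 2 (m≤m+n (qs φ) (qs ψ))) (m≤m+n (qv φ) (qv ψ)))

  q-binaryʳ : 2 ^ (qs φ + qs ψ) * (qv φ + qv ψ) ≤ Q → q ψ ≤ Q
  q-binaryʳ = ≤-trans (*-mono-≤ (^-monoʳ-≤ 2 (m≤n+m (qs ψ) (qs φ))) (m≤n+m (qv ψ) (qv φ)))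

module _ {c nv ns : ℕ} (φ : Formula c nv ns) {Q : ℕ} where

  q-vertexQuantifier : 2 ^ qs φ * suc (qv φ) ≤ Q → suc (q φ) ≤ Q
  q-vertexQuantifier = ≤-trans (≤-trans (+-monoˡ-≤ (q φ) (m^n>0 2 (qs φ))) (≤-reflexive (sym (*-suc (2 ^ qs φ) (qv φ)))))

  q-setQuantifier : 2 ^ suc (qs φ) * qv φ ≤ Q → q φ + q φ ≤ Q
  q-setQuantifier = ≤-trans (≤-reflexive (sym (trans (*-assoc 2 (2 ^ qs φ) (qv φ)) (cong (q φ +_) (+-identityʳ (q φ))))))

-- Similar assignments

equalities-∷ : ∀ {A : Set} {nv} {ρ ρ' : Fin nv → A} {v v'} →
               (∀ x y → ρ x ≡ ρ y → ρ' x ≡ ρ' y) → (∀ x → v ≡ ρ x → v' ≡ ρ' x) →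
               ∀ x y → (v VF.∷ ρ) x ≡ (v VF.∷ ρ) y → (v' VF.∷ ρ') x ≡ (v' VF.∷ ρ') y
equalities-∷ old new zero    zero    _   = refl
equalities-∷ old new zero    (suc y) v≡ρy = new y v≡ρy
equalities-∷ old new (suc x) zero    ρx≡v = sym (new x (sym ρx≡v))
equalities-∷ old new (suc x) (suc y) ρx≡ρy = old x y ρx≡ρy

module Similarity {n c : ℕ} (G : ColoredGraph n c) where
  open VertexTypes G

  assigned? : ∀ {nv} (ρ : Fin nv → Fin n) (u : Fin n) → Dec (∃ λ x → u ≡ ρ x)
  assigned? ρ u = any? λ x → u ≟ ρ x

  patternᵇ : ∀ {ns} → (Fin ns → Subset n) → (Fin ns → Bool) → Fin n → Bool
  patternᵇ ρs b u = allᵇ λ X → eqᵇ (lookup (ρs X) u) (b X)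

  -- w stands for its type class and b is a membership pattern for the set variables.
  cell : ∀ {nv ns} → (Fin nv → Fin n) → (Fin ns → Subset n) → Fin n → (Fin ns → Bool) → Fin n → Bool
  cell ρv ρs w b u = sameTypeᵇ G u w ∧ (patternᵇ ρs b u ∧ not (does (assigned? ρv u)))

  record Similar (Q : ℕ) {nv ns} (ρv : Fin nv → Fin n) (ρs : Fin ns → Subset n)
                 (ρv' : Fin nv → Fin n) (ρs' : Fin ns → Subset n) : Set where
    field
      equal→equal : ∀ x y → ρv x ≡ ρv y → ρv' x ≡ ρv' y
      equal←equal : ∀ x y → ρv' x ≡ ρv' y → ρv x ≡ ρv y
      same-type   : ∀ x → SameType (ρv x) (ρv' x)
      same-member : ∀ X x → lookup (ρs X) (ρv x) ≡ lookup (ρs' X) (ρv' x)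
      cells≈      : ∀ w b → count (cell ρv ρs w b) ≈[ Q ] count (cell ρv' ρs' w b)
  open Similar

  Similar-sym : ∀ {Q nv ns} {ρv ρv' : Fin nv → Fin n} {ρs ρs' : Fin ns → Subset n} →
                Similar Q ρv ρs ρv' ρs' → Similar Q ρv' ρs' ρv ρs
  Similar-sym S = record
    { equal→equal = equal←equal S
    ; equal←equal = equal→equal S
    ; same-type   = SameType-sym ∘ same-type S
    ; same-member = λ X x → sym (same-member S X x)
    ; cells≈      = λ w b → ≈-sym (cells≈ S w b)
    }

  Similar-mono : ∀ {Q Q' nv ns} {ρv ρv' : Fin nv → Fin n} {ρs ρs' : Fin ns → Subset n} →
                 Q' ≤ Q → Similar Q ρv ρs ρv' ρs' → Similar Q' ρv ρs ρv' ρs'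
  Similar-mono Q'≤Q S = record
    { equal→equal = equal→equal S
    ; equal←equal = equal←equal S
    ; same-type   = same-type S
    ; same-member = same-member S
    ; cells≈      = λ w b → ≈-mono Q'≤Q (cells≈ S w b)
    }

  sameTypeᵇ-respˡ : ∀ {a b} → SameType a b → ∀ z → sameTypeᵇ G a z ≡ sameTypeᵇ G b z
  sameTypeᵇ-respˡ a~b z = true⇔true⇒≡
    (sameTypeᵇ-complete _ _ ∘ SameType-trans (SameType-sym a~b) ∘ sameTypeᵇ-sound _ _)
    (sameTypeᵇ-complete _ _ ∘ SameType-trans a~b ∘ sameTypeᵇ-sound _ _)

  sameTypeᵇ-respʳ : ∀ {a b} → SameType a b → ∀ z → sameTypeᵇ G z a ≡ sameTypeᵇ G z b
  sameTypeᵇ-respʳ a~b z = true⇔true⇒≡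
    (sameTypeᵇ-complete _ _ ∘ (λ z~a → SameType-trans z~a a~b) ∘ sameTypeᵇ-sound _ _)
    (sameTypeᵇ-complete _ _ ∘ (λ z~b → SameType-trans z~b (SameType-sym a~b)) ∘ sameTypeᵇ-sound _ _)

  unassigned : ∀ {nv} (ρ : Fin nv → Fin n) (u : Fin n) → Set
  unassigned ρ u = ¬ ∃ λ x → u ≡ ρ x

  cell-sound : ∀ {nv ns} {ρv : Fin nv → Fin n} {ρs : Fin ns → Subset n} {w b u} →
               cell ρv ρs w b u ≡ true →
               SameType u w × (∀ X → lookup (ρs X) u ≡ b X) × unassigned ρv u
  cell-sound {ρv = ρv} {ρs} {w} {b} {u} in-cell
    with sameTypeᵇ G u w in u~w | patternᵇ ρs b u in matches | assigned? ρv u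
  ... | true | true | no u∉ρv =
    sameTypeᵇ-sound u w u~w , allᵇ-eqᵇ-sound (λ X → lookup (ρs X) u) b matches , u∉ρv

  cell-self : ∀ {nv ns} {ρv : Fin nv → Fin n} {ρs : Fin ns → Subset n} {v} → unassigned ρv v →
              cell ρv ρs v (λ X → lookup (ρs X) v) v ≡ true
  cell-self {ρv = ρv} {ρs} {v} v∉ρv
    rewrite sameTypeᵇ-complete v v (SameType-refl v)
          | allᵇ-eqᵇ-complete (λ X → lookup (ρs X) v) (λ X → lookup (ρs X) v) (λ _ → refl)
          | dec-false (assigned? ρv v) v∉ρv
    = refl

  cell-cong : ∀ {nv ns} (ρv : Fin nv → Fin n) (ρs : Fin ns → Subset n) {w w' b b'} →
              SameType w w' → (∀ X → b X ≡ b' X) → ∀ u → cell ρv ρs w b u ≡ cell ρv ρs w' b' u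
  cell-cong ρv ρs {b = b} {b'} w~w' b≗b' u =
    cong₂ _∧_ (sameTypeᵇ-respʳ w~w' u)
              (cong (_∧ _) (allᵇ-cong λ X → cong (eqᵇ (lookup (ρs X) u)) (b≗b' X)))

  cell-assigned : ∀ {nv ns} {ρv : Fin nv → Fin n} {ρs : Fin ns → Subset n} {w b v} y → v ≡ ρv y →
                  cell ρv ρs w b v ≡ false
  cell-assigned {ρv = ρv} {ρs} {w} {b} {v} y v≡ρy
    rewrite dec-true (assigned? ρv v) (y , v≡ρy) | ∧-zeroʳ (patternᵇ ρs b v) = ∧-zeroʳ (sameTypeᵇ G v w)

  cell-≡ : ∀ {nv ns} {ρv ρv' : Fin nv → Fin n} {ρs ρs' : Fin ns → Subset n} {v v'} →
           SameType v v' → (∀ X → lookup (ρs X) v ≡ lookup (ρs' X) v') →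
           unassigned ρv v → unassigned ρv' v' → ∀ w b → cell ρv ρs w b v ≡ cell ρv' ρs' w b v'
  cell-≡ {ρv = ρv} {ρv'} {v = v} {v'} v~v' same-members v∉ρv v'∉ρv' w b =
    cong₂ _∧_ (sameTypeᵇ-respˡ v~v' w)
      (cong₂ _∧_ (allᵇ-cong λ X → cong (λ t → eqᵇ t (b X)) (same-members X))
                 (cong not (trans (dec-false (assigned? ρv v) v∉ρv) (sym (dec-false (assigned? ρv' v') v'∉ρv')))))

  cell-∷ᵛ : ∀ {nv ns} (ρv : Fin nv → Fin n) (ρs : Fin ns → Subset n) v w b u →
            cell (v VF.∷ ρv) ρs w b u ≡ cell ρv ρs w b u ∧ not (does (u ≟ v))
  cell-∷ᵛ ρv ρs v w b u = lemma (sameTypeᵇ G u w) (patternᵇ ρs b u) (does (u ≟ v)) (does (assigned? ρv u))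
    where
    lemma : ∀ t p d a → t ∧ (p ∧ not (d ∨ a)) ≡ (t ∧ (p ∧ not a)) ∧ not d
    lemma false _     _     _     = refl
    lemma true  false _     _     = refl
    lemma true  true  true  a     = sym (∧-zeroʳ (not a))
    lemma true  true  false true  = refl
    lemma true  true  false false = refl

  count-cell-∷ᵛ : ∀ {nv ns} (ρv : Fin nv → Fin n) (ρs : Fin ns → Subset n) v w b →
                  count (cell (v VF.∷ ρv) ρs w b) ≡ count (λ u → cell ρv ρs w b u ∧ not (does (u ≟ v)))
  count-cell-∷ᵛ ρv ρs v w b = count-cong (cell-∷ᵛ ρv ρs v w b)

  count-cell-∷ᵛ-assigned : ∀ {nv ns} (ρv : Fin nv → Fin n) (ρs : Fin ns → Subset n) {v} y → v ≡ ρv y →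
                           ∀ w b → count (cell (v VF.∷ ρv) ρs w b) ≡ count (cell ρv ρs w b)
  count-cell-∷ᵛ-assigned ρv ρs {v} y v≡ρy w b =
    trans (count-cell-∷ᵛ ρv ρs v w b) (sym (count-remove-absent _ v (cell-assigned {ρv = ρv} {ρs} {w} {b} y v≡ρy)))

  module _ {Q nv ns} {ρv ρv' : Fin nv → Fin n} {ρs ρs' : Fin ns → Subset n}
           (S : Similar (suc Q) ρv ρs ρv' ρs') where

    extend-assigned : ∀ {v} y → v ≡ ρv y → Similar Q (v VF.∷ ρv) ρs (ρv' y VF.∷ ρv') ρs'
    extend-assigned {v} y v≡ρy = record
      { equal→equal = equalities-∷ (equal→equal S) λ x v≡ρx → equal→equal S y x (trans (sym v≡ρy) v≡ρx)
      ; equal←equal = equalities-∷ (equal←equal S) λ x ρ'y≡ρ'x → trans v≡ρy (equal←equal S y x ρ'y≡ρ'x)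
      ; same-type   = λ { zero → subst (λ t → SameType t (ρv' y)) (sym v≡ρy) (same-type S y)
                        ; (suc x) → same-type S x }
      ; same-member = λ { X zero → subst (λ t → lookup (ρs X) t ≡ lookup (ρs' X) (ρv' y)) (sym v≡ρy)
                                         (same-member S X y)
                        ; X (suc x) → same-member S X x }
      ; cells≈      = λ w b → ≈-mono (n≤1+n Q)
          (subst₂ _≈[ suc Q ]_ (sym (count-cell-∷ᵛ-assigned ρv ρs y v≡ρy w b))
                               (sym (count-cell-∷ᵛ-assigned ρv' ρs' y refl w b))
                               (cells≈ S w b))
      }

    -- v is unassigned, so its cell has a positive count on the left, hence on
    -- the right, which provides the answer v'.
    extend-unassigned : ∀ {v} → unassigned ρv v → Σ (Fin n) λ v' → Similar Q (v VF.∷ ρv) ρs (v' VF.∷ ρv') ρs'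
    extend-unassigned {v} v∉ρv
      with count-pos-witness (cell ρv' ρs' v (λ X → lookup (ρs X) v))
             (≈-pos (cells≈ S v _) (count-pos _ v (cell-self {ρs = ρs} v∉ρv)))
    ... | v' , v'∈cell with cell-sound {ρv = ρv'} {ρs'} v'∈cell
    ... | v'~v , v'-members , v'∉ρv' = v' , record
      { equal→equal = equalities-∷ (equal→equal S) λ x v≡ρx → contradiction (x , v≡ρx) v∉ρv
      ; equal←equal = equalities-∷ (equal←equal S) λ x v'≡ρ'x → contradiction (x , v'≡ρ'x) v'∉ρv'
      ; same-type   = λ { zero → SameType-sym v'~v ; (suc x) → same-type S x }
      ; same-member = λ { X zero → sym (v'-members X) ; X (suc x) → same-member S X x }
      ; cells≈      = λ w b → subst₂ _≈[ Q ]_ (sym (count-cell-∷ᵛ ρv ρs v w b)) (sym (count-cell-∷ᵛ ρv' ρs' v' w b))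
                        (count-remove-≈ {f = cell ρv ρs w b} {cell ρv' ρs' w b} (cells≈ S w b)
                          (cell-≡ {ρs = ρs} {ρs'} (SameType-sym v'~v) (sym ∘ v'-members) v∉ρv v'∉ρv' w b))
      }

    extendᵛ : ∀ v → Σ (Fin n) λ v' → Similar Q (v VF.∷ ρv) ρs (v' VF.∷ ρv') ρs'
    extendᵛ v with assigned? ρv v
    ... | yes (y , v≡ρy) = ρv' y , extend-assigned y v≡ρy
    ... | no v∉ρv        = extend-unassigned v∉ρv

  cell-∷ˢ : ∀ {nv ns} (ρv : Fin nv → Fin n) (ρs : Fin ns → Subset n) Y w b u →
            cell ρv (Y VF.∷ ρs) w b u ≡ cell ρv ρs w (b ∘ suc) u ∧ eqᵇ (lookup Y u) (b zero)
  cell-∷ˢ ρv ρs Y w b u =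
    lemma (sameTypeᵇ G u w) (eqᵇ (lookup Y u) (b zero)) (patternᵇ ρs (b ∘ suc) u) (not (does (assigned? ρv u)))
    where
    lemma : ∀ t e p a → t ∧ ((e ∧ p) ∧ a) ≡ (t ∧ (p ∧ a)) ∧ e
    lemma false _     _ _ = refl
    lemma true  true  p a = sym (∧-identityʳ (p ∧ a))
    lemma true  false p a = sym (∧-zeroʳ (p ∧ a))

  count-cell-∷ˢ : ∀ {nv ns} (ρv : Fin nv → Fin n) (ρs : Fin ns → Subset n) Y w b →
                  count (cell ρv (Y VF.∷ ρs) w b) ≡
                  (if b zero then count (λ u → cell ρv ρs w (b ∘ suc) u ∧ lookup Y u)
                   else count (cell ρv ρs w (b ∘ suc)) ∸ count (λ u → cell ρv ρs w (b ∘ suc) u ∧ lookup Y u))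
  count-cell-∷ˢ ρv ρs Y w b =
    trans (count-cong (cell-∷ˢ ρv ρs Y w b)) (count-∧-eqᵇ (cell ρv ρs w (b ∘ suc)) (lookup Y) (b zero))

  module _ {Q nv ns} {ρv ρv' : Fin nv → Fin n} {ρs ρs' : Fin ns → Subset n}
           (S : Similar (Q + Q) ρv ρs ρv' ρs') (X : Subset n) where

    part : Fin n → (Fin ns → Bool) → ℕ
    part w b = matchingPart Q (count (cell ρv ρs w b)) (count (cell ρv' ρs' w b))
                              (count (λ u → cell ρv ρs w b u ∧ lookup X u))

    part-spec : ∀ w b → let k = part w b in
                k ≤ count (cell ρv' ρs' w b) ×
                count (λ u → cell ρv ρs w b u ∧ lookup X u) ≈[ Q ] k ×
                count (cell ρv ρs w b) ∸ count (λ u → cell ρv ρs w b u ∧ lookup X u)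
                  ≈[ Q ] count (cell ρv' ρs' w b) ∸ k
    part-spec w b = matchingPart-spec Q (cells≈ S w b) (count-∧≤count (cell ρv ρs w b) (lookup X))

    part-cong : ∀ {w w' b b'} → SameType w w' → (∀ Y → b Y ≡ b' Y) → part w b ≡ part w' b'
    part-cong w~w' b≗b' = cong₃ (matchingPart Q)
      (count-cong (cell-cong ρv ρs w~w' b≗b'))
      (count-cong (cell-cong ρv' ρs' w~w' b≗b'))
      (count-cong λ u → cong (_∧ _) (cell-cong ρv ρs w~w' b≗b' u))
      where
      cong₃ : ∀ (f : ℕ → ℕ → ℕ → ℕ) {a a' b b' c c'} → a ≡ a' → b ≡ b' → c ≡ c' → f a b c ≡ f a' b' c'
      cong₃ f refl refl refl = refl

    members' : Fin n → Fin ns → Bool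
    members' u Y = lookup (ρs' Y) u

    -- On assigned vertices X' copies X; in every cell of unassigned vertices
    -- it takes the first `part` ones.
    X'-member : Fin n → Bool
    X'-member u with assigned? ρv' u
    ... | yes (y , _) = lookup X (ρv y)
    ... | no _        = rank (cell ρv' ρs' u (members' u)) u <ᵇ part u (members' u)

    X' : Subset n
    X' = tabulate X'-member

    X'-assigned : ∀ x → lookup X' (ρv' x) ≡ lookup X (ρv x)
    X'-assigned x rewrite lookup∘tabulate X'-member (ρv' x) with assigned? ρv' (ρv' x)
    ... | yes (y , ρ'x≡ρ'y) = cong (lookup X) (sym (equal←equal S x y ρ'x≡ρ'y))
    ... | no unassigned     = contradiction (x , refl) unassigned

    X'-in-cell : ∀ {w b u} → cell ρv' ρs' w b u ≡ true →
                 lookup X' u ≡ (rank (cell ρv' ρs' w b) u <ᵇ part w b)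
    X'-in-cell {w} {b} {u} u∈cell with cell-sound {ρv = ρv'} {ρs'} u∈cell
    ... | u~w , u-members , u∉ρv' rewrite lookup∘tabulate X'-member u with assigned? ρv' u
    ...   | yes assigned = contradiction assigned u∉ρv'
    ...   | no _         = cong₂ _<ᵇ_
            (count-cong λ z → cong ((toℕ z <ᵇ toℕ u) ∧_) (cell-cong ρv' ρs' u~w u-members z))
            (part-cong u~w u-members)

    count-X'-in-cell : ∀ w b → count (λ u → cell ρv' ρs' w b u ∧ lookup X' u) ≡ part w b
    count-X'-in-cell w b = begin
      count (λ u → cell ρv' ρs' w b u ∧ lookup X' u)                         ≡⟨ count-cong in-cell ⟩
      count (λ u → cell ρv' ρs' w b u ∧ (rank (cell ρv' ρs' w b) u <ᵇ part w b)) ≡⟨ count-rank< (cell ρv' ρs' w b) (part w b) ⟩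
      part w b ⊓ count (cell ρv' ρs' w b)                                     ≡⟨ m≤n⇒m⊓n≡m (proj₁ (part-spec w b)) ⟩
      part w b                                                                ∎
      where
      open ≡-Reasoning
      in-cell : ∀ u → cell ρv' ρs' w b u ∧ lookup X' u ≡ cell ρv' ρs' w b u ∧ (rank (cell ρv' ρs' w b) u <ᵇ part w b)
      in-cell u with cell ρv' ρs' w b u in u∈cell
      ... | false = refl
      ... | true  = X'-in-cell u∈cell

    extendˢ : Σ (Subset n) λ X' → Similar Q ρv (X VF.∷ ρs) ρv' (X' VF.∷ ρs')
    extendˢ = X' , record
      { equal→equal = equal→equal S
      ; equal←equal = equal←equal S
      ; same-type   = same-type S
      ; same-member = λ { zero x → sym (X'-assigned x) ; (suc Y) x → same-member S Y x }
      ; cells≈      = cells≈'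
      }
      where
      cells≈' : ∀ w b → count (cell ρv (X VF.∷ ρs) w b) ≈[ Q ] count (cell ρv' (X' VF.∷ ρs') w b)
      cells≈' w b rewrite count-cell-∷ˢ ρv ρs X w b | count-cell-∷ˢ ρv' ρs' X' w b
                        | count-X'-in-cell w (b ∘ suc) =
        ≈-if (b zero) (proj₁ (proj₂ (part-spec w (b ∘ suc)))) (proj₂ (proj₂ (part-spec w (b ∘ suc))))

  adj-Similar : ∀ {Q nv ns} {ρv ρv' : Fin nv → Fin n} {ρs ρs' : Fin ns → Subset n} →
                Similar Q ρv ρs ρv' ρs' → ∀ x y → adj G (ρv x) (ρv y) ≡ adj G (ρv' x) (ρv' y)
  adj-Similar {ρv = ρv} {ρv'} S x y with ρv x ≟ ρv y
  ... | no ρx≢ρy = adj-SameType (same-type S x) (same-type S y) ρx≢ρy (ρx≢ρy ∘ equal←equal S x y)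
  ... | yes ρx≡ρy = begin
    adj G (ρv x) (ρv y)   ≡⟨ cong (adj G (ρv x)) ρx≡ρy ⟨
    adj G (ρv x) (ρv x)   ≡⟨ irrefl G (ρv x) ⟩
    false                 ≡⟨ irrefl G (ρv' x) ⟨
    adj G (ρv' x) (ρv' x) ≡⟨ cong (adj G (ρv' x)) (equal→equal S x y ρx≡ρy) ⟩
    adj G (ρv' x) (ρv' y) ∎
    where open ≡-Reasoning

  Sat-transfer : ∀ {Q nv ns} (φ : Formula c nv ns) → q φ ≤ Q →
                 ∀ {ρv ρv' : Fin nv → Fin n} {ρs ρs' : Fin ns → Subset n} →
                 Similar Q ρv ρs ρv' ρs' → Sat G φ ρv ρs → Sat G φ ρv' ρs'
  Sat-transfer (eqv x y) _ S ρx≡ρy = equal→equal S x y ρx≡ρy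
  Sat-transfer (edge x y) _ S x~y = trans (sym (adj-Similar S x y)) x~y
  Sat-transfer (col i x) _ {ρv} {ρv'} S x∈Cᵢ =
    lookup⇒[]= (ρv' x) (color G i) (trans (sym (proj₂ (same-type S x) i)) ([]=⇒lookup x∈Cᵢ))
  Sat-transfer (mem X x) _ {ρv} {ρv'} {ρs} {ρs'} S x∈X =
    lookup⇒[]= (ρv' x) (ρs' X) (trans (sym (same-member S X x)) ([]=⇒lookup x∈X))
  Sat-transfer (neg φ) q≤Q S ¬φ = ¬φ ∘ Sat-transfer φ q≤Q (Similar-sym S)
  Sat-transfer (conj φ ψ) q≤Q S (sφ , sψ) =
    Sat-transfer φ (q-binaryˡ φ ψ q≤Q) S sφ , Sat-transfer ψ (q-binaryʳ φ ψ q≤Q) S sψ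
  Sat-transfer (disj φ ψ) q≤Q S (inj₁ sφ) = inj₁ (Sat-transfer φ (q-binaryˡ φ ψ q≤Q) S sφ)
  Sat-transfer (disj φ ψ) q≤Q S (inj₂ sψ) = inj₂ (Sat-transfer ψ (q-binaryʳ φ ψ q≤Q) S sψ)
  Sat-transfer (impl φ ψ) q≤Q S φ⇒ψ =
    Sat-transfer ψ (q-binaryʳ φ ψ q≤Q) S ∘ φ⇒ψ ∘ Sat-transfer φ (q-binaryˡ φ ψ q≤Q) (Similar-sym S)
  Sat-transfer (iff φ ψ) q≤Q S (φ⇒ψ , ψ⇒φ) =
    Sat-transfer ψ (q-binaryʳ φ ψ q≤Q) S ∘ φ⇒ψ ∘ Sat-transfer φ (q-binaryˡ φ ψ q≤Q) (Similar-sym S) ,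
    Sat-transfer φ (q-binaryˡ φ ψ q≤Q) S ∘ ψ⇒φ ∘ Sat-transfer ψ (q-binaryʳ φ ψ q≤Q) (Similar-sym S)
  Sat-transfer (exV φ) q≤Q S (v , sφ)
    with extendᵛ (Similar-mono (q-vertexQuantifier φ q≤Q) S) v
  ... | v' , S' = v' , Sat-transfer φ ≤-refl S' sφ
  Sat-transfer (allV φ) q≤Q S ∀φ v'
    with extendᵛ (Similar-mono (q-vertexQuantifier φ q≤Q) (Similar-sym S)) v'
  ... | v , S' = Sat-transfer φ ≤-refl (Similar-sym S') (∀φ v)
  Sat-transfer (exS φ) q≤Q S (X , sφ)
    with extendˢ (Similar-mono (q-setQuantifier φ q≤Q) S) X
  ... | X' , S' = X' , Sat-transfer φ ≤-refl S' sφ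
  Sat-transfer (allS φ) q≤Q S ∀φ X'
    with extendˢ (Similar-mono (q-setQuantifier φ q≤Q) (Similar-sym S)) X'
  ... | X , S' = Sat-transfer φ ≤-refl (Similar-sym S') (∀φ X)

  typeClass-count : ∀ w → ∣ typeClass G w ∣ ≡ count (λ u → sameTypeᵇ G u w)
  typeClass-count w = trans (∣p∣≡count (typeClass G w)) (count-cong (lookup∘tabulate (λ u → sameTypeᵇ G u w)))

  signature-count : ∀ R w → signature G R w ≡ count (λ u → sameTypeᵇ G u w ∧ lookup R u)
  signature-count R w = trans (∣p∣≡count (typeClass G w ∩ R)) (count-cong λ u →
    trans (lookup-zipWith _∧_ u (typeClass G w) R) (cong (_∧ lookup R u) (lookup∘tabulate (λ u → sameTypeᵇ G u w) u)))

  count-cell-initial : ∀ (ρ : Fin 0 → Fin n) R w b →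
    count (cell ρ (λ (_ : Fin 1) → R) w b) ≡
    (if b zero then signature G R w else ∣ typeClass G w ∣ ∸ signature G R w)
  count-cell-initial ρ R w b = begin
    count (cell ρ (λ (_ : Fin 1) → R) w b)
      ≡⟨ count-cong (λ u → cong (sameTypeᵇ G u w ∧_) (trans (∧-identityʳ _) (∧-identityʳ _))) ⟩
    count (λ u → sameTypeᵇ G u w ∧ eqᵇ (lookup R u) (b zero))
      ≡⟨ count-∧-eqᵇ (λ u → sameTypeᵇ G u w) (lookup R) (b zero) ⟩
    _ ≡⟨ cong₂ (λ size sig → if b zero then sig else size ∸ sig) (typeClass-count w) (signature-count R w) ⟨
    _ ∎
    where open ≡-Reasoning

  Similar-initial : ∀ {Q} {ρ ρ' : Fin 0 → Fin n} {R R'} → SameShape G Q R R' →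
                    Similar Q ρ (λ (_ : Fin 1) → R) ρ' (λ (_ : Fin 1) → R')
  Similar-initial {Q} {ρ} {ρ'} {R} {R'} (_ , R-shape , R'-shape) = record
    { equal→equal = λ ()
    ; equal←equal = λ ()
    ; same-type   = λ ()
    ; same-member = λ _ ()
    ; cells≈      = λ w b → subst₂ _≈[ Q ]_ (sym (count-cell-initial ρ R w b)) (sym (count-cell-initial ρ' R' w b))
        (≈-if (b zero) (proj₁ (shapes≈ w)) (proj₂ (shapes≈ w)))
    }
    where
    shapes≈ : ∀ w → signature G R w ≈[ Q ] signature G R' w ×
                    ∣ typeClass G w ∣ ∸ signature G R w ≈[ Q ] ∣ typeClass G w ∣ ∸ signature G R' w
    shapes≈ w = shapeValue-≈ Q _ _ _ (trans (sym (R-shape w)) (R'-shape w))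

lemma3p4 : {n c : ℕ} (φ : Formula c 0 1) (G : ColoredGraph n c)
           (S S' : Subset n) (k : ℕ) →
           G ⊨ φ [ S ] → G ⊨ φ [ S' ] →
           ∣ S ∣ ≡ k → ∣ S' ∣ ≡ k →
           Σ (Fin c) (λ i → color G i ≡ S) →
           Σ (Fin c) (λ j → color G j ≡ S') →
           (R R' : Subset n) →
           SameShape G (q φ) R R' →
           (G ⊨ φ [ R ] → G ⊨ φ [ R' ]) × (G ⊨ φ [ R' ] → G ⊨ φ [ R ])
lemma3p4 φ G _ _ _ _ _ _ _ _ _ R R' same-shape =
  Sat-transfer φ ≤-refl (Similar-initial same-shape) ,
  Sat-transfer φ ≤-refl (Similar-sym (Similar-initial same-shape))
  where open Similarity G
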